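{- Let $n\ge 2$ and let $\Gamma$ be the bijection from $n\times n$ alternating sign matrices to gog triangles of size $n$. Reversing the order of the rows of an $n\times n$ alternating sign matrix induces an involution $f=\Gamma\circ\mathrm{rev}\circ\Gamma^{ -1}$ on the set $\mathcal{G}_n$ of gog triangles of size $n$, where $\mathrm{rev}$ denotes row reversal. Moreover, for every $G\in\mathcal{G}_n$, the two-color pyramid of $f(G)$ is obtained from the two-color pyramid of $G$ by reversing the color of every cube and moving each cube at position $(i,j,k)$ to position $(n-i,k,j)$.
   Context: An $n\times n$ alternating sign matrix is a matrix with entries in $\{0,1,-1\}$ such that each row and column sums to $1$ and the nonzero entries in each row and each column alternate in sign. A gog triangle of size $n$ is an array of positive integers $G(i,j)$, $1\le j\le i\le n$, such that $G(i,j)\le n-i+j$; $G(i,j)<G(i,j+1)$; $G(i,j)\ge G(i+1,j)$; and $G(i,j)\le G(i+1,j+1)$, whenever the entries are defined. The bijection $\Gamma$: for an ASM $A$ and each $i$, the sum of the first $i$ rows of $A$ is a $0$-$1$ vector with exactly $i$ ones, and row $i$ of $\Gamma(A)$ lists the positions of those ones in increasing order. The two-color pyramid of a gog triangle $G$ is the set of cube positions $(i,j,k)$ with $1\le j\le i\le n-1$ and $1\le k\le n-i$, where the cube at $(i,j,k)$ is white if $k\le G(i,j)-j$ and gray otherwise (i.e. the tower at $(i,j)$ has $G(i,j)-j$ white cubes stacked below $n-i-(G(i,j)-j)$ gray cubes; the last row of $G$ is always $1,2,\ldots,n$ and is omitted). -}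

module Defs where

open import Data.Nat using (ℕ; zero; suc; _+_; _∸_; _≤_; _<_; _≤ᵇ_; _≤?_)
open import Data.Nat.Properties using ()
open import Data.Integer as ℤ using (ℤ; +_; -[1+_])
open import Data.Fin using (Fin; toℕ; opposite)
open import Data.List using (List; []; _∷_; map; filter; allFin)
open import Data.Bool using (Bool; not)
open import Data.Product using (_×_; Σ)
open import Data.Sum using (_⊎_)
open import Data.Unit using (⊤)
open import Relation.Binary.PropositionalEquality using (_≡_; _≢_)
open import Relation.Nullary using (¬_)
open import Relation.Nullary.Decidable using (¬?)

Matrix : ℕ → Set
Matrix n = Fin n → Fin n → ℤ

sumℤ : List ℤ → ℤ
sumℤ []       = + 0
sumℤ (x ∷ xs) = x ℤ.+ xs'
  where xs' = sumℤ xs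

nonzeros : List ℤ → List ℤ
nonzeros = filter (λ x → ¬? (x ℤ.≟ + 0))

Alternating : List ℤ → Set
Alternating []           = ⊤
Alternating (x ∷ [])     = ⊤
Alternating (x ∷ y ∷ xs) = (x ℤ.* y ≡ -[1+ 0 ]) × Alternating (y ∷ xs)

IsASMLine : List ℤ → Set
IsASMLine v = sumℤ v ≡ + 1 × Alternating (nonzeros v)

row : ∀ {n} → Matrix n → Fin n → List ℤ
row {n} A i = map (λ j → A i j) (allFin n)

col : ∀ {n} → Matrix n → Fin n → List ℤ
col {n} A j = map (λ i → A i j) (allFin n)

IsASM : (n : ℕ) → Matrix n → Set
IsASM n A =
  (∀ i j → A i j ≡ + 0 ⊎ A i j ≡ + 1 ⊎ A i j ≡ -[1+ 0 ]) ×
  (∀ i → IsASMLine (row A i)) ×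
  (∀ j → IsASMLine (col A j))

rev : ∀ {n} → Matrix n → Matrix n
rev A i j = A (opposite i) j

-- Gog triangles: G i j for 1 ≤ j ≤ i ≤ n (1-based indices; values
-- outside this range are irrelevant)

Triangle : Set
Triangle = ℕ → ℕ → ℕ

IsGog : (n : ℕ) → Triangle → Set
IsGog n G =
  (∀ i j → 1 ≤ j → j ≤ i → i ≤ n → 1 ≤ G i j × G i j ≤ n ∸ i + j) ×
  (∀ i j → 1 ≤ j → j < i → i ≤ n → G i j < G i (suc j)) ×
  (∀ i j → 1 ≤ j → j ≤ i → i < n → G (suc i) j ≤ G i j) ×
  (∀ i j → 1 ≤ j → j ≤ i → i < n → G i j ≤ G (suc i) (suc j))

_≈[_]_ : Triangle → ℕ → Triangle → Set
G ≈[ n ] H = ∀ i j → 1 ≤ j → j ≤ i → i ≤ n → G i j ≡ H i j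

partialColSum : ∀ {n} → Matrix n → ℕ → Fin n → ℤ
partialColSum {n} A i c =
  sumℤ (map (λ r → A r c) (filter (λ r → suc (toℕ r) ≤? i) (allFin n)))

onesPositions : ∀ {n} → Matrix n → ℕ → List ℕ
onesPositions {n} A i =
  map (λ c → suc (toℕ c)) (filter (λ c → partialColSum A i c ℤ.≟ + 1) (allFin n))

-- j-th element (1-based) of a list, 0 if absent
nth : List ℕ → ℕ → ℕ
nth []       _             = 0
nth (x ∷ xs) zero          = 0
nth (x ∷ xs) (suc zero)    = x
nth (x ∷ xs) (suc (suc j)) = nth xs (suc j)

Γ : ∀ {n} → Matrix n → Triangle
Γ A i j = nth (onesPositions A i) j

IsCubePos : ℕ → ℕ → ℕ → ℕ → Set
IsCubePos n i j k = 1 ≤ j × j ≤ i × i ≤ n ∸ 1 × 1 ≤ k × k ≤ n ∸ i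

-- colour of the cube at (i,j,k): true = white, false = gray
white : Triangle → ℕ → ℕ → ℕ → Bool
white G i j k = k ≤ᵇ (G i j ∸ j)

PyramidFlip : ℕ → Triangle → Triangle → Set
PyramidFlip n G H =
  ∀ i j k → IsCubePos n i j k → white H (n ∸ i) k j ≡ not (white G i j k)

-- Let K(i,c) be the sum of the top-left i × c block of the ASM A. Every line of
-- an ASM has all its prefix sums in {0,1}, so the sum of the first i rows is a
-- 0-1 vector and K(i,c) counts its ones among the first c positions. Hence
-- Γ A i j is the least c with K(i,c) ≥ j, and each gog inequality for Γ A is
-- an inequality between the functions K(i,·): they start at 0, grow by at most
-- one per step in either index, and K(i,n) = i. Reversing the rows replaces
-- K(i,c) by K'(n-i,c) = c - K(i,c), since every column sums to 1; in terms of
-- the least-c description this exchanges the white and gray cubes of the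
-- tower over (i,j) with those over (n-i,k).
module Submission where

open import Defs
open import Data.Bool using (Bool; true; false; not)
open import Data.Empty using (⊥-elim)
open import Data.Fin using (Fin; toℕ; opposite; fromℕ; fromℕ<; inject₁)
  renaming (zero to fzero; suc to fsuc)
open import Data.Fin.Properties using (opposite-involutive)
open import Data.Integer as ℤ using (ℤ; +_; -[1+_])
import Data.Integer.Properties as ℤP
open import Algebra.Properties.CommutativeSemigroup ℤP.+-commutativeSemigroup using (interchange)
open import Data.List
  using (List; []; _∷_; [_]; _++_; _∷ʳ_; _ʳ++_; map; filter; take; drop; reverse; tabulate; allFin; length)
import Data.List.Properties as LP
open import Data.List.Relation.Unary.All as All using (All; []; _∷_)
import Data.List.Relation.Unary.All.Properties as AllP
open import Data.Nat using (ℕ; zero; suc; _+_; _∸_; _≤_; _<_; z≤n; s≤s; s≤s⁻¹; _≤?_; _≤ᵇ_)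
import Data.Nat.Properties as ℕP
open import Data.Product using (_×_; _,_; proj₁; proj₂; ∃)
open import Data.Sum using (_⊎_; inj₁; inj₂)
open import Data.Unit using (⊤; tt)
open import Function using (_∘_; id; _⇔_; mk⇔; Equivalence)
open import Relation.Nullary using (¬_; yes; no; does; ¬?)
open import Relation.Nullary.Decidable using (does-⇔)
open import Relation.Unary using (Pred; Decidable)
open import Relation.Binary.PropositionalEquality hiding ([_])

open Equivalence using (to; from)

take-length-++ : ∀ {a} {A : Set a} (xs ys : List A) → take (length xs) (xs ++ ys) ≡ xs
take-length-++ []       ys = refl
take-length-++ (x ∷ xs) ys = cong (x ∷_) (take-length-++ xs ys)

take-reverse : ∀ {a} {A : Set a} i (xs : List A) →
               take (length xs ∸ i) (reverse xs) ≡ reverse (drop i xs)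
take-reverse {A = A} i xs = begin
  take (length xs ∸ i) (reverse xs)              ≡⟨ cong₂ take (sym (LP.length-drop i xs)) reverse-split ⟩
  take (length (drop i xs)) (back ++ front)      ≡⟨ cong (λ m → take m (back ++ front)) (sym (LP.length-reverse (drop i xs))) ⟩
  take (length back) (back ++ front)             ≡⟨ take-length-++ back front ⟩
  back                                           ∎
  where
  open ≡-Reasoning
  back front : List A
  back  = reverse (drop i xs)
  front = reverse (take i xs)
  reverse-split : reverse xs ≡ back ++ front
  reverse-split = trans (cong reverse (sym (LP.take++drop≡id i xs))) (LP.reverse-++ (take i xs) (drop i xs))

module _ {a p} {A : Set a} {P : Pred A p} (P? : Decidable P) where

  filter-ʳ++ : ∀ xs ys → filter P? (xs ʳ++ ys) ≡ filter P? xs ʳ++ filter P? ys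
  filter-ʳ++ []       ys = refl
  filter-ʳ++ (x ∷ xs) ys = trans (filter-ʳ++ xs (x ∷ ys)) move-x
    where
    move-x : filter P? xs ʳ++ filter P? (x ∷ ys) ≡ filter P? (x ∷ xs) ʳ++ filter P? ys
    move-x with does (P? x)
    ... | true  = refl
    ... | false = refl

  filter-reverse : ∀ xs → filter P? (reverse xs) ≡ reverse (filter P? xs)
  filter-reverse xs = filter-ʳ++ xs []

  filter-map : ∀ {b} {B : Set b} (f : B → A) xs → filter P? (map f xs) ≡ map f (filter (P? ∘ f) xs)
  filter-map f []       = refl
  filter-map f (x ∷ xs) with does (P? (f x))
  ... | true  = cong (f x ∷_) (filter-map f xs)
  ... | false = filter-map f xs

tabulate-∷ʳ : ∀ {a} {A : Set a} n (f : Fin (suc n) → A) →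
              tabulate f ≡ tabulate (f ∘ inject₁) ∷ʳ f (fromℕ n)
tabulate-∷ʳ zero    f = refl
tabulate-∷ʳ (suc n) f = cong (f fzero ∷_) (tabulate-∷ʳ n (f ∘ fsuc))

tabulate-opposite : ∀ {a} {A : Set a} n (f : Fin n → A) →
                    tabulate (f ∘ opposite) ≡ reverse (tabulate f)
tabulate-opposite zero    f = refl
tabulate-opposite (suc n) f = begin
  f (fromℕ n) ∷ tabulate (f ∘ inject₁ ∘ opposite)   ≡⟨ cong (f (fromℕ n) ∷_) (tabulate-opposite n (f ∘ inject₁)) ⟩
  f (fromℕ n) ∷ reverse (tabulate (f ∘ inject₁))    ≡⟨ LP.reverse-++ (tabulate (f ∘ inject₁)) [ f (fromℕ n) ] ⟨
  reverse (tabulate (f ∘ inject₁) ∷ʳ f (fromℕ n))   ≡⟨ cong reverse (tabulate-∷ʳ n f) ⟨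
  reverse (tabulate f)                              ∎
  where open ≡-Reasoning

filter-index<-allFin : ∀ n i → filter (λ r → suc (toℕ r) ≤? i) (allFin n) ≡ take i (allFin n)
filter-index<-allFin zero    i       = sym (LP.take-[] i)
filter-index<-allFin (suc n) zero    = LP.filter-none (λ r → suc (toℕ r) ≤? 0) (AllP.tabulate⁺ {f = fsuc} λ _ ())
filter-index<-allFin (suc n) (suc i) = cong (fzero ∷_) (begin
  filter (λ r → suc (toℕ r) ≤? suc i) (tabulate fsuc)
    ≡⟨ cong (filter _) (sym (LP.map-tabulate id fsuc)) ⟩
  filter (λ r → suc (toℕ r) ≤? suc i) (map fsuc (allFin n))
    ≡⟨ filter-map _ fsuc (allFin n) ⟩
  map fsuc (filter (λ r → suc (suc (toℕ r)) ≤? suc i) (allFin n))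
    ≡⟨ cong (map fsuc) (LP.filter-≐ _ _ (s≤s⁻¹ , s≤s) (allFin n)) ⟩
  map fsuc (filter (λ r → suc (toℕ r) ≤? i) (allFin n))
    ≡⟨ cong (map fsuc) (filter-index<-allFin n i) ⟩
  map fsuc (take i (allFin n))
    ≡⟨ LP.take-map i (allFin n) ⟨
  take i (map fsuc (allFin n))
    ≡⟨ cong (take i) (LP.map-tabulate id fsuc) ⟩
  take i (tabulate fsuc) ∎)
  where open ≡-Reasoning

sum-++ : ∀ xs ys → sumℤ (xs ++ ys) ≡ sumℤ xs ℤ.+ sumℤ ys
sum-++ []       ys = sym (ℤP.+-identityˡ _)
sum-++ (x ∷ xs) ys = trans (cong (ℤ._+_ x) (sum-++ xs ys)) (sym (ℤP.+-assoc x _ _))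

sum-reverse : ∀ xs → sumℤ (reverse xs) ≡ sumℤ xs
sum-reverse []       = refl
sum-reverse (x ∷ xs) = begin
  sumℤ (reverse (x ∷ xs))              ≡⟨ cong sumℤ (LP.unfold-reverse x xs) ⟩
  sumℤ (reverse xs ∷ʳ x)               ≡⟨ sum-++ (reverse xs) [ x ] ⟩
  sumℤ (reverse xs) ℤ.+ (x ℤ.+ + 0)    ≡⟨ cong₂ ℤ._+_ (sum-reverse xs) (ℤP.+-identityʳ x) ⟩
  sumℤ xs ℤ.+ x                        ≡⟨ ℤP.+-comm (sumℤ xs) x ⟩
  sumℤ (x ∷ xs)                        ∎
  where open ≡-Reasoning

sum-take-reverse : ∀ i v → sumℤ (take (length v ∸ i) (reverse v)) ℤ.+ sumℤ (take i v) ≡ sumℤ v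
sum-take-reverse i v = begin
  sumℤ (take (length v ∸ i) (reverse v)) ℤ.+ sumℤ (take i v)
    ≡⟨ cong (ℤ._+ sumℤ (take i v)) (trans (cong sumℤ (take-reverse i v)) (sum-reverse (drop i v))) ⟩
  sumℤ (drop i v) ℤ.+ sumℤ (take i v)
    ≡⟨ ℤP.+-comm (sumℤ (drop i v)) _ ⟩
  sumℤ (take i v) ℤ.+ sumℤ (drop i v)
    ≡⟨ sym (sum-++ (take i v) (drop i v)) ⟩
  sumℤ (take i v ++ drop i v)
    ≡⟨ cong sumℤ (LP.take++drop≡id i v) ⟩
  sumℤ v ∎
  where open ≡-Reasoning

ZeroOr : ℤ → ℤ → Set
ZeroOr s x = x ≡ + 0 ⊎ x ≡ s

IsASMEntry : ℤ → Set
IsASMEntry x = x ≡ + 0 ⊎ x ≡ + 1 ⊎ x ≡ -[1+ 0 ]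

PlusMinusOne : ℤ → Set
PlusMinusOne x = x ≡ + 1 ⊎ x ≡ -[1+ 0 ]

AlternatingFrom : ℤ → List ℤ → Set
AlternatingFrom s []      = ⊤
AlternatingFrom s (x ∷ w) = x ≡ s × AlternatingFrom (ℤ.- s) w

prefixSums-alternatingFrom : ∀ s v → AlternatingFrom s (nonzeros v) →
                             ∀ k → ZeroOr s (sumℤ (take k v))
prefixSums-alternatingFrom s v       _   zero    = inj₁ refl
prefixSums-alternatingFrom s []      _   (suc k) = inj₁ refl
prefixSums-alternatingFrom s (x ∷ v) alt (suc k) with x ℤ.≟ + 0
... | yes refl = subst (ZeroOr s) (sym (ℤP.+-identityˡ _)) (prefixSums-alternatingFrom s v alt k)
... | no _ with alt
...   | refl , alt′ with prefixSums-alternatingFrom (ℤ.- x) v alt′ k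
...     | inj₁ rest≡0  = inj₂ (trans (cong (ℤ._+_ x) rest≡0) (ℤP.+-identityʳ x))
...     | inj₂ rest≡-x = inj₁ (trans (cong (ℤ._+_ x) rest≡-x) (ℤP.+-inverseʳ x))

alternatingFrom-head : ∀ {x w} → All PlusMinusOne (x ∷ w) → Alternating (x ∷ w) →
                       AlternatingFrom x (x ∷ w)
alternatingFrom-head {w = []} _ _ = refl , tt
alternatingFrom-head (inj₁ refl ∷ inj₁ refl ∷ _) (() , _)
alternatingFrom-head (inj₁ refl ∷ pm@(inj₂ refl ∷ _)) (_ , alt) = refl , alternatingFrom-head pm alt
alternatingFrom-head (inj₂ refl ∷ pm@(inj₁ refl ∷ _)) (_ , alt) = refl , alternatingFrom-head pm alt
alternatingFrom-head (inj₂ refl ∷ inj₂ refl ∷ _) (() , _)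

alternating⇒alternatingFrom : ∀ {w} → All PlusMinusOne w → Alternating w →
                              ∃ λ s → AlternatingFrom s w
alternating⇒alternatingFrom {[]}    _  _   = + 1 , tt
alternating⇒alternatingFrom {x ∷ w} pm alt = x , alternatingFrom-head pm alt

nonzeros-plusMinusOne : ∀ {v} → All IsASMEntry v → All PlusMinusOne (nonzeros v)
nonzeros-plusMinusOne {v} entries =
  All.zipWith nonzero⇒± (AllP.all-filter _ v , AllP.filter⁺ _ entries)
  where
  nonzero⇒± : ∀ {x} → ¬ x ≡ + 0 × IsASMEntry x → PlusMinusOne x
  nonzero⇒± (x≢0 , inj₁ x≡0) = ⊥-elim (x≢0 x≡0)
  nonzero⇒± (_   , inj₂ ±1)  = ±1

-- The first nonzero entry of a line is +1: otherwise every prefix sum, and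
-- in particular the whole sum, would lie in {0, -1}.
asmLine-prefixSums : ∀ {v} → All IsASMEntry v → IsASMLine v →
                     ∀ k → ZeroOr (+ 1) (sumℤ (take k v))
asmLine-prefixSums {v} entries (sum≡1 , alt)
  with alternating⇒alternatingFrom (nonzeros-plusMinusOne entries) alt
... | s , altFrom = subst (λ s → ∀ k → ZeroOr s (sumℤ (take k v))) s≡1 prefixSums
  where
  prefixSums : ∀ k → ZeroOr s (sumℤ (take k v))
  prefixSums = prefixSums-alternatingFrom s v altFrom
  sum≡ : sumℤ (take (length v) v) ≡ + 1
  sum≡ = trans (cong sumℤ (LP.take-all (length v) v ℕP.≤-refl)) sum≡1
  s≡1 : s ≡ + 1
  s≡1 with prefixSums (length v)
  ... | inj₁ sum≡0 with trans (sym sum≡) sum≡0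
  ...   | ()
  s≡1 | inj₂ sum≡s = trans (sym sum≡s) sum≡

alternating-ʳ++ : ∀ {x acc} xs → Alternating (x ∷ xs) → Alternating (x ∷ acc) →
                  Alternating (xs ʳ++ (x ∷ acc))
alternating-ʳ++         []       _          alt-acc = alt-acc
alternating-ʳ++ {x} (y ∷ xs) (xy , alt) alt-acc =
  alternating-ʳ++ xs alt (trans (ℤP.*-comm y x) xy , alt-acc)

alternating-reverse : ∀ xs → Alternating xs → Alternating (reverse xs)
alternating-reverse []       _   = tt
alternating-reverse (x ∷ xs) alt = alternating-ʳ++ xs alt tt

asmLine-reverse : ∀ v → IsASMLine v → IsASMLine (reverse v)
asmLine-reverse v (sum≡1 , alt) =
  trans (sum-reverse v) sum≡1 ,
  subst Alternating (sym (filter-reverse _ v)) (alternating-reverse _ alt)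

FirstReach : (ℕ → ℕ) → ℕ → ℕ → Set
FirstReach K j x = ∀ c → x ≤ c ⇔ j ≤ K c

StepsAtMostOne : (ℕ → ℕ) → Set
StepsAtMostOne K = ∀ c → K (suc c) ≤ suc (K c)

module _ {K : ℕ → ℕ} where

  stepsAtMostOne-+ : StepsAtMostOne K → ∀ c d → K (c + d) ≤ K c + d
  stepsAtMostOne-+ steps c zero rewrite ℕP.+-identityʳ c | ℕP.+-identityʳ (K c) = ℕP.≤-refl
  stepsAtMostOne-+ steps c (suc d) rewrite ℕP.+-suc c d | ℕP.+-suc (K c) d =
    ℕP.≤-trans (steps (c + d)) (s≤s (stepsAtMostOne-+ steps c d))

  firstReach-positive : ∀ {j x} → 1 ≤ j → K 0 ≡ 0 → FirstReach K j x → 1 ≤ x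
  firstReach-positive {x = suc _} _         _    _     = s≤s z≤n
  firstReach-positive {x = zero}  (s≤s _) K0≡0 reach with subst (_ ≤_) K0≡0 (to (reach 0) z≤n)
  ... | ()

  firstReach-≤ : ∀ {j x c d} → StepsAtMostOne K → FirstReach K j x → j + d ≤ K (c + d) → x ≤ c
  firstReach-≤ {j} {c = c} {d} steps reach j+d≤ =
    from (reach c) (ℕP.+-cancelʳ-≤ d j (K c) (ℕP.≤-trans j+d≤ (stepsAtMostOne-+ steps c d)))

  firstReach-< : ∀ {j x y} → StepsAtMostOne K → 1 ≤ x → FirstReach K j x → FirstReach K (suc j) y → x < y
  firstReach-< {j} {suc x} {y} steps _ reach reach′ = ℕP.≰⇒> y≰x
    where
    y≰x : ¬ y ≤ suc x
    y≰x y≤x = ℕP.<-irrefl refl (from (reach x) (s≤s⁻¹ (ℕP.≤-trans (to (reach′ (suc x)) y≤x) (steps x))))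

  firstReach-white : ∀ {j g} k → FirstReach K j g → (suc k ≤ᵇ g ∸ j) ≡ not (does (j ≤? K (j + k)))
  firstReach-white {j} {g} k reach = does-⇔ (mk⇔ white⇒ white⇐) (suc k ≤? g ∸ j) (¬? (j ≤? K (j + k)))
    where
    white⇒ : suc k ≤ g ∸ j → ¬ j ≤ K (j + k)
    white⇒ k<g∸j j≤K = ℕP.<⇒≱ j+k<g (from (reach (j + k)) j≤K)
      where
      j<g : j < g
      j<g = ℕP.m∸n≢0⇒n<m (ℕP.m<n⇒n≢0 k<g∸j)
      j+k<g : j + k < g
      j+k<g = subst (_≤ g) (cong suc (ℕP.+-comm k j)) (ℕP.m≤o∸n⇒m+n≤o (suc k) (ℕP.<⇒≤ j<g) k<g∸j)
    white⇐ : ¬ j ≤ K (j + k) → suc k ≤ g ∸ j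
    white⇐ j≰K = ℕP.m+n≤o⇒m≤o∸n (suc k) (subst (_≤ g) (cong suc (ℕP.+-comm j k)) j+k<g)
      where
      j+k<g : j + k < g
      j+k<g = ℕP.≰⇒> (j≰K ∘ to (reach (j + k)))

module _ {K K′ : ℕ → ℕ} where

  firstReach-antitone : ∀ {j x y} → (∀ c → K c ≤ K′ c) → FirstReach K j x → FirstReach K′ j y → y ≤ x
  firstReach-antitone K≤K′ reach reach′ = from (reach′ _) (ℕP.≤-trans (to (reach _) ℕP.≤-refl) (K≤K′ _))

  firstReach-shift : ∀ {j x y} → (∀ c → K′ c ≤ suc (K c)) →
                     FirstReach K j x → FirstReach K′ (suc j) y → x ≤ y
  firstReach-shift K′≤K+1 reach reach′ =
    from (reach _) (s≤s⁻¹ (ℕP.≤-trans (to (reach′ _) ℕP.≤-refl) (K′≤K+1 _)))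

complement-thresholds : ∀ a b x y → a + b ≡ suc (x + y) → does (suc x ≤? a) ≡ not (does (suc y ≤? b))
complement-thresholds a b x y a+b≡ = does-⇔ (mk⇔ above⇒ above⇐) (suc x ≤? a) (¬? (suc y ≤? b))
  where
  above⇒ : suc x ≤ a → ¬ suc y ≤ b
  above⇒ x<a y<b = ℕP.1+n≰n (begin
    suc (suc (x + y)) ≡⟨ cong suc (ℕP.+-suc x y) ⟨
    suc x + suc y     ≤⟨ ℕP.+-mono-≤ x<a y<b ⟩
    a + b             ≡⟨ a+b≡ ⟩
    suc (x + y)       ∎)
    where open ℕP.≤-Reasoning
  above⇐ : ¬ suc y ≤ b → suc x ≤ a
  above⇐ y≮b = ℕP.+-cancelʳ-≤ y (suc x) a (begin
    suc x + y ≡⟨ a+b≡ ⟨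
    a + b     ≤⟨ ℕP.+-monoʳ-≤ a (s≤s⁻¹ (ℕP.≰⇒> y≮b)) ⟩
    a + y     ∎)
    where open ℕP.≤-Reasoning

positions : List Bool → List ℕ
positions []           = []
positions (true  ∷ bs) = 1 ∷ map suc (positions bs)
positions (false ∷ bs) = map suc (positions bs)

countTrue : List Bool → ℕ
countTrue []           = 0
countTrue (true  ∷ bs) = suc (countTrue bs)
countTrue (false ∷ bs) = countTrue bs

filter-tabulate-fsuc : ∀ {n p} {P : Pred (Fin (suc n)) p} (P? : Decidable P) →
                       map (suc ∘ toℕ) (filter P? (tabulate fsuc)) ≡
                       map suc (map (suc ∘ toℕ) (filter (P? ∘ fsuc) (allFin n)))
filter-tabulate-fsuc {n} P? = begin
  map (suc ∘ toℕ) (filter P? (tabulate fsuc))                  ≡⟨ cong (map (suc ∘ toℕ) ∘ filter P?) (LP.map-tabulate id fsuc) ⟨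
  map (suc ∘ toℕ) (filter P? (map fsuc (allFin n)))            ≡⟨ cong (map (suc ∘ toℕ)) (filter-map P? fsuc (allFin n)) ⟩
  map (suc ∘ toℕ) (map fsuc (filter (P? ∘ fsuc) (allFin n)))   ≡⟨ LP.map-∘ _ ⟨
  map (suc ∘ suc ∘ toℕ) (filter (P? ∘ fsuc) (allFin n))        ≡⟨ LP.map-∘ _ ⟩
  map suc (map (suc ∘ toℕ) (filter (P? ∘ fsuc) (allFin n)))    ∎
  where open ≡-Reasoning

positions-allFin : ∀ {n p} {P : Pred (Fin n) p} (P? : Decidable P) →
                   map (suc ∘ toℕ) (filter P? (allFin n)) ≡ positions (tabulate (does ∘ P?))
positions-allFin {zero}  P? = refl
positions-allFin {suc n} P? with does (P? fzero)
... | true  = cong (1 ∷_) (trans (filter-tabulate-fsuc P?) (cong (map suc) (positions-allFin (P? ∘ fsuc))))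
... | false = trans (filter-tabulate-fsuc P?) (cong (map suc) (positions-allFin (P? ∘ fsuc)))

countTrue-take-suc : ∀ bs → StepsAtMostOne (λ c → countTrue (take c bs))
countTrue-take-suc []           c       = z≤n
countTrue-take-suc (true  ∷ bs) zero    = s≤s z≤n
countTrue-take-suc (false ∷ bs) zero    = z≤n
countTrue-take-suc (true  ∷ bs) (suc c) = s≤s (countTrue-take-suc bs c)
countTrue-take-suc (false ∷ bs) (suc c) = countTrue-take-suc bs c

length-positions : ∀ bs → length (positions bs) ≡ countTrue bs
length-positions []           = refl
length-positions (true  ∷ bs) = cong suc (trans (LP.length-map suc (positions bs)) (length-positions bs))
length-positions (false ∷ bs) = trans (LP.length-map suc (positions bs)) (length-positions bs)

nth-map-suc : ∀ xs j → suc j ≤ length xs → nth (map suc xs) (suc j) ≡ suc (nth xs (suc j))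
nth-map-suc (x ∷ xs) zero    _         = refl
nth-map-suc (x ∷ xs) (suc j) (s≤s j<) = nth-map-suc xs j j<

nth-positions : ∀ bs j → suc j ≤ countTrue bs →
                FirstReach (λ c → countTrue (take c bs)) (suc j) (nth (positions bs) (suc j))
nth-positions (true ∷ bs) zero _ = λ where
  zero    → mk⇔ (λ ()) (λ ())
  (suc c) → mk⇔ (λ _ → s≤s z≤n) (λ _ → s≤s z≤n)
nth-positions (true ∷ bs) (suc j) (s≤s j<)
  rewrite nth-map-suc (positions bs) j (subst (suc j ≤_) (sym (length-positions bs)) j<) = λ where
  zero    → mk⇔ (λ ()) (λ ())
  (suc c) → let reach = nth-positions bs j j< c in
            mk⇔ (s≤s ∘ to reach ∘ s≤s⁻¹) (s≤s ∘ from reach ∘ s≤s⁻¹)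
nth-positions (false ∷ bs) j j<
  rewrite nth-map-suc (positions bs) j (subst (suc j ≤_) (sym (length-positions bs)) j<) = λ where
  zero    → mk⇔ (λ ()) (λ ())
  (suc c) → let reach = nth-positions bs j j< c in
            mk⇔ (to reach ∘ s≤s⁻¹) (s≤s ∘ from reach)

isOne : ℤ → Bool
isOne x = does (x ℤ.≟ + 1)

countTrue-isOne : ∀ {v} → All (ZeroOr (+ 1)) v → + countTrue (map isOne v) ≡ sumℤ v
countTrue-isOne []                = refl
countTrue-isOne (inj₁ refl ∷ bits) = trans (countTrue-isOne bits) (sym (ℤP.+-identityˡ _))
countTrue-isOne (inj₂ refl ∷ bits) = cong (ℤ._+_ (+ 1)) (countTrue-isOne bits)

prefixSum : ∀ {n} → (Fin n → ℤ) → ℕ → ℤ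
prefixSum f c = sumℤ (take c (tabulate f))

countTrue-isOne-prefix : ∀ {n} {f : Fin n → ℤ} → (∀ x → ZeroOr (+ 1) (f x)) →
                         ∀ c → + countTrue (take c (tabulate (isOne ∘ f))) ≡ prefixSum f c
countTrue-isOne-prefix {f = f} bits c = begin
  + countTrue (take c (tabulate (isOne ∘ f)))  ≡⟨ cong (λ bs → + countTrue (take c bs)) (LP.map-tabulate f isOne) ⟨
  + countTrue (take c (map isOne (tabulate f))) ≡⟨ cong (+_ ∘ countTrue) (LP.take-map c (tabulate f)) ⟩
  + countTrue (map isOne (take c (tabulate f))) ≡⟨ countTrue-isOne (AllP.take⁺ c (AllP.tabulate⁺ bits)) ⟩
  prefixSum f c                                 ∎
  where open ≡-Reasoning

prefixSum-cong : ∀ {n} {f g : Fin n → ℤ} → (∀ x → f x ≡ g x) → ∀ c → prefixSum f c ≡ prefixSum g c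
prefixSum-cong f≗g c = cong (sumℤ ∘ take c) (LP.tabulate-cong f≗g)

prefixSum-+ : ∀ {n} (f g : Fin n → ℤ) c → prefixSum (λ x → f x ℤ.+ g x) c ≡ prefixSum f c ℤ.+ prefixSum g c
prefixSum-+         f g zero    = refl
prefixSum-+ {zero}  f g (suc c) = refl
prefixSum-+ {suc n} f g (suc c) =
  trans (cong (ℤ._+_ (f fzero ℤ.+ g fzero)) (prefixSum-+ (f ∘ fsuc) (g ∘ fsuc) c))
        (interchange (f fzero) (g fzero) (prefixSum (f ∘ fsuc) c) (prefixSum (g ∘ fsuc) c))

prefixSum-suc : ∀ {n} (h : Fin n → ℤ) {i} (i<n : i < n) → prefixSum h (suc i) ≡ prefixSum h i ℤ.+ h (fromℕ< i<n)
prefixSum-suc {suc n} h {zero}  _       = trans (ℤP.+-identityʳ (h fzero)) (sym (ℤP.+-identityˡ (h fzero)))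
prefixSum-suc {suc n} h {suc i} (s≤s i<n) =
  trans (cong (ℤ._+_ (h fzero)) (prefixSum-suc (h ∘ fsuc) i<n)) (sym (ℤP.+-assoc (h fzero) _ _))

prefixSum-all : ∀ {n} (h : Fin n → ℤ) → prefixSum h n ≡ sumℤ (tabulate h)
prefixSum-all {n} h = cong sumℤ (LP.take-all n (tabulate h) (ℕP.≤-reflexive (LP.length-tabulate h)))

prefixSum-zeros : ∀ {n} c → prefixSum {n} (λ _ → + 0) c ≡ + 0
prefixSum-zeros         zero    = refl
prefixSum-zeros {zero}  (suc c) = refl
prefixSum-zeros {suc n} (suc c) = trans (ℤP.+-identityˡ _) (prefixSum-zeros {n} c)

prefixSum-ones : ∀ {n c} → c ≤ n → prefixSum {n} (λ _ → + 1) c ≡ + c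
prefixSum-ones {c = zero}  _       = refl
prefixSum-ones {c = suc c} (s≤s c≤n) = cong (ℤ._+_ (+ 1)) (prefixSum-ones c≤n)

bit-increment : ∀ {a b s} → + b ≡ + a ℤ.+ s → ZeroOr (+ 1) s → a ≤ b × b ≤ suc a
bit-increment {a} b≡a+s (inj₁ refl) with ℤP.+-injective (trans b≡a+s (ℤP.+-identityʳ (+ a)))
... | refl = ℕP.≤-refl , ℕP.n≤1+n a
bit-increment {a} b≡a+s (inj₂ refl) with trans (ℤP.+-injective b≡a+s) (ℕP.+-comm a 1)
... | refl = ℕP.n≤1+n a , ℕP.≤-refl

col-tabulate : ∀ {n} (A : Matrix n) j → col A j ≡ tabulate (λ i → A i j)
col-tabulate A j = LP.map-tabulate id (λ i → A i j)

row-tabulate : ∀ {n} (A : Matrix n) i → row A i ≡ tabulate (A i)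
row-tabulate A i = LP.map-tabulate id (A i)

col-rev : ∀ {n} (A : Matrix n) j → col (rev A) j ≡ reverse (col A j)
col-rev {n} A j = begin
  col (rev A) j                         ≡⟨ col-tabulate (rev A) j ⟩
  tabulate ((λ i → A i j) ∘ opposite)   ≡⟨ tabulate-opposite n (λ i → A i j) ⟩
  reverse (tabulate (λ i → A i j))      ≡⟨ cong reverse (col-tabulate A j) ⟨
  reverse (col A j)                     ∎
  where open ≡-Reasoning

rev-isASM : ∀ {n} {A : Matrix n} → IsASM n A → IsASM n (rev A)
rev-isASM {A = A} (entries , rows , cols) =
  (λ i → entries (opposite i)) ,
  (λ i → rows (opposite i)) ,
  (λ j → subst IsASMLine (sym (col-rev A j)) (asmLine-reverse (col A j) (cols j)))

rev-involutive : ∀ {n} (A : Matrix n) i j → rev (rev A) i j ≡ A i j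
rev-involutive A i j = cong (λ r → A r j) (opposite-involutive i)

partialColSum≡prefixSum : ∀ {n} (A : Matrix n) i c → partialColSum A i c ≡ prefixSum (λ r → A r c) i
partialColSum≡prefixSum {n} A i c = cong sumℤ (begin
  map column (filter (λ r → suc (toℕ r) ≤? i) (allFin n)) ≡⟨ cong (map column) (filter-index<-allFin n i) ⟩
  map column (take i (allFin n))                           ≡⟨ LP.take-map i (allFin n) ⟨
  take i (map column (allFin n))                           ≡⟨ cong (take i) (LP.map-tabulate id column) ⟩
  take i (tabulate column)                                 ∎)
  where
  open ≡-Reasoning
  column : Fin n → ℤ
  column r = A r c

-- Rows 1..i of A and rows 1..n-i of rev A together make up each column exactly once.
partialColSum-rev : ∀ {n} {A : Matrix n} → IsASM n A →
                    ∀ i c → partialColSum (rev A) (n ∸ i) c ℤ.+ partialColSum A i c ≡ + 1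
partialColSum-rev {n} {A} (_ , _ , cols) i c = begin
  partialColSum (rev A) (n ∸ i) c ℤ.+ partialColSum A i c
    ≡⟨ cong₂ ℤ._+_ (partialColSum≡prefixSum (rev A) (n ∸ i) c) (partialColSum≡prefixSum A i c) ⟩
  sumℤ (take (n ∸ i) (tabulate (column ∘ opposite))) ℤ.+ sumℤ (take i v)
    ≡⟨ cong₂ (λ m w → sumℤ (take (m ∸ i) w) ℤ.+ sumℤ (take i v))
             (sym (LP.length-tabulate column)) (tabulate-opposite n column) ⟩
  sumℤ (take (length v ∸ i) (reverse v)) ℤ.+ sumℤ (take i v)
    ≡⟨ sum-take-reverse i v ⟩
  sumℤ v
    ≡⟨ cong sumℤ (col-tabulate A c) ⟨
  sumℤ (col A c)
    ≡⟨ proj₁ (cols c) ⟩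
  + 1 ∎
  where
  open ≡-Reasoning
  column : Fin n → ℤ
  column r = A r c
  v : List ℤ
  v = tabulate column

-- corner i c is the sum of the top-left i × c block of A.
module Corners {n} {A : Matrix n} (asm : IsASM n A) where

  private
    entries : ∀ i j → IsASMEntry (A i j)
    entries = proj₁ asm
    rows : ∀ i → IsASMLine (row A i)
    rows = proj₁ (proj₂ asm)
    cols : ∀ j → IsASMLine (col A j)
    cols = proj₂ (proj₂ asm)

  colPrefix-01 : ∀ i x → ZeroOr (+ 1) (partialColSum A i x)
  colPrefix-01 i x = subst (ZeroOr (+ 1)) (sym (partialColSum≡prefixSum A i x))
    (asmLine-prefixSums (AllP.tabulate⁺ (λ r → entries r x)) (subst IsASMLine (col-tabulate A x) (cols x)) i)

  rowPrefix-01 : ∀ r c → ZeroOr (+ 1) (prefixSum (A r) c)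
  rowPrefix-01 r = asmLine-prefixSums (AllP.tabulate⁺ (entries r)) (subst IsASMLine (row-tabulate A r) (rows r))

  ones : ℕ → List Bool
  ones i = tabulate (isOne ∘ partialColSum A i)

  corner : ℕ → ℕ → ℕ
  corner i c = countTrue (take c (ones i))

  corner-ℤ : ∀ i c → + corner i c ≡ prefixSum (partialColSum A i) c
  corner-ℤ i = countTrue-isOne-prefix (colPrefix-01 i)

  corner-steps : ∀ i → StepsAtMostOne (corner i)
  corner-steps i = countTrue-take-suc (ones i)

  corner-zero : ∀ c → corner 0 c ≡ 0
  corner-zero c = ℤP.+-injective (begin
    + corner 0 c                      ≡⟨ corner-ℤ 0 c ⟩
    prefixSum (partialColSum A 0) c   ≡⟨ prefixSum-cong (partialColSum≡prefixSum A 0) c ⟩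
    prefixSum (λ _ → + 0) c           ≡⟨ prefixSum-zeros c ⟩
    + 0                               ∎)
    where open ≡-Reasoning

  corner-suc : ∀ {i} (i<n : i < n) c → + corner (suc i) c ≡ + corner i c ℤ.+ prefixSum (A (fromℕ< i<n)) c
  corner-suc {i} i<n c = begin
    + corner (suc i) c                                             ≡⟨ corner-ℤ (suc i) c ⟩
    prefixSum (partialColSum A (suc i)) c                          ≡⟨ prefixSum-cong addRow c ⟩
    prefixSum (λ x → partialColSum A i x ℤ.+ A r x) c              ≡⟨ prefixSum-+ (partialColSum A i) (A r) c ⟩
    prefixSum (partialColSum A i) c ℤ.+ prefixSum (A r) c          ≡⟨ cong (ℤ._+ prefixSum (A r) c) (corner-ℤ i c) ⟨
    + corner i c ℤ.+ prefixSum (A r) c                             ∎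
    where
    open ≡-Reasoning
    r : Fin n
    r = fromℕ< i<n
    addRow : ∀ x → partialColSum A (suc i) x ≡ partialColSum A i x ℤ.+ A r x
    addRow x = begin
      partialColSum A (suc i) x                     ≡⟨ partialColSum≡prefixSum A (suc i) x ⟩
      prefixSum (λ r → A r x) (suc i)               ≡⟨ prefixSum-suc (λ r → A r x) i<n ⟩
      prefixSum (λ r → A r x) i ℤ.+ A r x           ≡⟨ cong (ℤ._+ A r x) (partialColSum≡prefixSum A i x) ⟨
      partialColSum A i x ℤ.+ A r x                 ∎

  corner-rows : ∀ {i} → i < n → ∀ c → corner i c ≤ corner (suc i) c × corner (suc i) c ≤ suc (corner i c)
  corner-rows i<n c = bit-increment (corner-suc i<n c) (rowPrefix-01 (fromℕ< i<n) c)

  corner-full : ∀ {i} → i ≤ n → corner i n ≡ i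
  corner-full {zero}  _   = corner-zero n
  corner-full {suc i} i<n = ℤP.+-injective (begin
    + corner (suc i) n                          ≡⟨ corner-suc i<n n ⟩
    + corner i n ℤ.+ prefixSum (A r) n          ≡⟨ cong₂ ℤ._+_ (cong +_ (corner-full (ℕP.<⇒≤ i<n))) rowSum ⟩
    + i ℤ.+ + 1                                 ≡⟨ cong +_ (ℕP.+-comm i 1) ⟩
    + suc i                                     ∎)
    where
    open ≡-Reasoning
    r : Fin n
    r = fromℕ< i<n
    rowSum : prefixSum (A r) n ≡ + 1
    rowSum = trans (prefixSum-all (A r)) (trans (cong sumℤ (sym (row-tabulate A r))) (proj₁ (rows r)))

  Γ-firstReach : ∀ {i j} → 1 ≤ j → j ≤ i → i ≤ n → FirstReach (corner i) j (Γ A i j)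
  Γ-firstReach {i} {suc j} _ j<i i≤n =
    subst (FirstReach (corner i) (suc j)) (cong (λ ps → nth ps (suc j)) (sym Γ-positions))
      (nth-positions (ones i) j (subst (suc j ≤_) (sym countTrue≡i) j<i))
    where
    Γ-positions : onesPositions A i ≡ positions (ones i)
    Γ-positions = positions-allFin (λ x → partialColSum A i x ℤ.≟ + 1)
    countTrue≡i : countTrue (ones i) ≡ i
    countTrue≡i = trans (cong countTrue (sym (LP.take-all n (ones i) (ℕP.≤-reflexive (LP.length-tabulate _)))))
                        (corner-full i≤n)

corner-complement : ∀ {n} {A : Matrix n} (asm : IsASM n A) i {c} → c ≤ n →
                    Corners.corner (rev-isASM asm) (n ∸ i) c + Corners.corner asm i c ≡ c
corner-complement {n} {A} asm i {c} c≤n = ℤP.+-injective (begin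
  + (R.corner (n ∸ i) c + A.corner i c)
    ≡⟨ cong₂ ℤ._+_ (R.corner-ℤ (n ∸ i) c) (A.corner-ℤ i c) ⟩
  prefixSum (partialColSum (rev A) (n ∸ i)) c ℤ.+ prefixSum (partialColSum A i) c
    ≡⟨ prefixSum-+ (partialColSum (rev A) (n ∸ i)) (partialColSum A i) c ⟨
  prefixSum (λ x → partialColSum (rev A) (n ∸ i) x ℤ.+ partialColSum A i x) c
    ≡⟨ prefixSum-cong (partialColSum-rev asm i) c ⟩
  prefixSum (λ _ → + 1) c
    ≡⟨ prefixSum-ones c≤n ⟩
  + c ∎)
  where
  open ≡-Reasoning
  module A = Corners asm
  module R = Corners (rev-isASM asm)

Γ-isGog : ∀ {n} {A : Matrix n} → IsASM n A → IsGog n (Γ A)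
Γ-isGog {n} {A} asm = bounds , increasing , descending , diagonal
  where
  open Corners asm
  bounds : ∀ i j → 1 ≤ j → j ≤ i → i ≤ n → 1 ≤ Γ A i j × Γ A i j ≤ n ∸ i + j
  bounds i j 1≤j j≤i i≤n =
    firstReach-positive 1≤j refl reach ,
    firstReach-≤ (corner-steps i) reach (subst (λ m → j + (i ∸ j) ≤ corner i m) (sym total) reachesAt-n)
    where
    reach : FirstReach (corner i) j (Γ A i j)
    reach = Γ-firstReach 1≤j j≤i i≤n
    total : n ∸ i + j + (i ∸ j) ≡ n
    total = trans (ℕP.+-assoc (n ∸ i) j (i ∸ j)) (trans (cong (_+_ (n ∸ i)) (ℕP.m+[n∸m]≡n j≤i)) (ℕP.m∸n+n≡m i≤n))
    reachesAt-n : j + (i ∸ j) ≤ corner i n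
    reachesAt-n = ℕP.≤-reflexive (trans (ℕP.m+[n∸m]≡n j≤i) (sym (corner-full i≤n)))
  increasing : ∀ i j → 1 ≤ j → j < i → i ≤ n → Γ A i j < Γ A i (suc j)
  increasing i j 1≤j j<i i≤n =
    firstReach-< (corner-steps i) (firstReach-positive 1≤j refl reach) reach (Γ-firstReach (s≤s z≤n) j<i i≤n)
    where
    reach : FirstReach (corner i) j (Γ A i j)
    reach = Γ-firstReach 1≤j (ℕP.<⇒≤ j<i) i≤n
  descending : ∀ i j → 1 ≤ j → j ≤ i → i < n → Γ A (suc i) j ≤ Γ A i j
  descending i j 1≤j j≤i i<n =
    firstReach-antitone (proj₁ ∘ corner-rows i<n)
      (Γ-firstReach 1≤j j≤i (ℕP.<⇒≤ i<n)) (Γ-firstReach 1≤j (ℕP.m≤n⇒m≤1+n j≤i) i<n)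
  diagonal : ∀ i j → 1 ≤ j → j ≤ i → i < n → Γ A i j ≤ Γ A (suc i) (suc j)
  diagonal i j 1≤j j≤i i<n =
    firstReach-shift (proj₂ ∘ corner-rows i<n)
      (Γ-firstReach 1≤j j≤i (ℕP.<⇒≤ i<n)) (Γ-firstReach (s≤s z≤n) (s≤s j≤i) i<n)

-- Both colours are read off the corners at column j + k − 1, where the corners
-- of A and rev A sum to j + k − 1; this is what swaps them.
Γ-rev-pyramidFlip : ∀ {n} {A : Matrix n} → IsASM n A → PyramidFlip n (Γ A) (Γ (rev A))
Γ-rev-pyramidFlip {n} {A} asm i (suc j) (suc k) (s≤s z≤n , j<i , i≤n-1 , s≤s z≤n , k<n-i) = begin
  white (Γ (rev A)) (n ∸ i) (suc k) (suc j)
    ≡⟨ firstReach-white j (R.Γ-firstReach (s≤s z≤n) k<n-i (ℕP.m∸n≤m n i)) ⟩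
  not (does (suc k ≤? R.corner (n ∸ i) (suc (k + j))))
    ≡⟨ cong not (complement-thresholds (R.corner (n ∸ i) c) (A.corner i c) k j (corner-complement asm i c≤n)) ⟩
  not (not (does (suc j ≤? A.corner i (suc (k + j)))))
    ≡⟨ cong (λ m → not (not (does (suc j ≤? A.corner i (suc m))))) (ℕP.+-comm k j) ⟩
  not (not (does (suc j ≤? A.corner i (suc (j + k)))))
    ≡⟨ cong not (firstReach-white k (A.Γ-firstReach (s≤s z≤n) j<i i≤n)) ⟨
  not (white (Γ A) i (suc j) (suc k)) ∎
  where
  open ≡-Reasoning
  module A = Corners asm
  module R = Corners (rev-isASM asm)
  i≤n : i ≤ n
  i≤n = ℕP.≤-trans i≤n-1 (ℕP.m∸n≤m n 1)
  c : ℕ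
  c = suc (k + j)
  c≤n : c ≤ n
  c≤n = ℕP.≤-trans (ℕP.+-mono-≤ k<n-i (ℕP.≤-trans (ℕP.n≤1+n j) j<i)) (ℕP.≤-reflexive (ℕP.m∸n+n≡m i≤n))

pyramidFlip-resp-≈ : ∀ {n G G′ H} → G ≈[ n ] G′ → PyramidFlip n G H → PyramidFlip n G′ H
pyramidFlip-resp-≈ {n} {H = H} G≈G′ flip i j k pos@(1≤j , j≤i , i≤n-1 , _) =
  subst (λ g → white H (n ∸ i) k j ≡ not (k ≤ᵇ g ∸ j))
        (G≈G′ i j 1≤j j≤i (ℕP.≤-trans i≤n-1 (ℕP.m∸n≤m n 1))) (flip i j k pos)

mainTheorem9 : (n : ℕ) → 2 ≤ n →
    (A : Matrix n) → IsASM n A →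
    (G : Triangle) → IsGog n G → Γ A ≈[ n ] G →
    IsASM n (rev A) × (∀ i j → rev (rev A) i j ≡ A i j) ×
    IsGog n (Γ (rev A)) × PyramidFlip n G (Γ (rev A))
mainTheorem9 n _ A asm G _ Γ≈G =
  rev-isASM asm ,
  rev-involutive A ,
  Γ-isGog (rev-isASM asm) ,
  pyramidFlip-resp-≈ {H = Γ (rev A)} Γ≈G (Γ-rev-pyramidFlip asm)
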